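{- Let $r,k\geq 2$ be integers and let $G$ be a (non-empty) $(v,b,r,k)$-configuration. Then there exist three edges of $G$ whose six endpoints are pairwise distinct.
   Context: For positive integers $v,b,r,k$, a $(v,b,r,k)$-configuration is a connected bipartite graph with $v$ vertices on one side, each of degree $r$, and $b$ vertices on the other side, each of degree $k$, containing no cycle of length $4$. -}

module Defs where

open import Data.Nat using (ℕ; zero; suc)
open import Data.Fin using (Fin)
open import Data.Bool using (Bool; true; false)
open import Data.Product using (_×_; Σ; ∃)
open import Relation.Binary.PropositionalEquality using (_≡_)
open import Relation.Nullary using (¬_)
open import Data.Sum using (_⊎_)

-- A bipartite graph with point side Fin v and block side Fin b,
-- given by its (0/1) incidence relation: point p is adjacent to block B
-- iff  I p B ≡ true.
Incidence : ℕ → ℕ → Set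
Incidence v b = Fin v → Fin b → Bool

count : {n : ℕ} → (Fin n → Bool) → ℕ
count {zero}  f = 0
count {suc n} f with f Fin.zero
... | true  = suc (count {n} (λ i → f (Fin.suc i)))
... | false = count {n} (λ i → f (Fin.suc i))

Vertex : ℕ → ℕ → Set
Vertex v b = Fin v ⊎ Fin b

data Adj {v b : ℕ} (I : Incidence v b) : Vertex v b → Vertex v b → Set where
  pb : (p : Fin v) (B : Fin b) → I p B ≡ true → Adj I (Data.Sum.inj₁ p) (Data.Sum.inj₂ B)
  bp : (p : Fin v) (B : Fin b) → I p B ≡ true → Adj I (Data.Sum.inj₂ B) (Data.Sum.inj₁ p)

data Reach {v b : ℕ} (I : Incidence v b) : Vertex v b → Vertex v b → Set where
  here : (x : Vertex v b) → Reach I x x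
  step : (x y z : Vertex v b) → Adj I x y → Reach I y z → Reach I x z

Connected : {v b : ℕ} → Incidence v b → Set
Connected {v} {b} I = (x y : Vertex v b) → Reach I x y

NoC4 : {v b : ℕ} → Incidence v b → Set
NoC4 {v} {b} I = (p q : Fin v) (B C : Fin b) → ¬ p ≡ q → ¬ B ≡ C →
  ¬ (I p B ≡ true × I p C ≡ true × I q B ≡ true × I q C ≡ true)

record IsConfiguration (v b r k : ℕ) (I : Incidence v b) : Set where
  field
    pointDeg  : (p : Fin v) → count (I p) ≡ r
    blockDeg  : (B : Fin b) → count (λ p → I p B) ≡ k
    connected : Connected I
    noC4      : NoC4 I

-- Take a point p on two blocks B₁ ≠ B₂, a second point q₁ of B₁ and a second
-- point q₂ of B₂, and a block C ≠ B₁ through q₁. Since p and q₁ already share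
-- B₁, the absence of 4-cycles keeps q₁ off B₂; hence q₁ ≠ q₂ and C ≠ B₂, and
-- the edges q₁C, pB₁, q₂B₂ have six distinct endpoints.
module Submission where

open import Defs
open import Data.Nat using (ℕ; _≤_)
open import Data.Nat.Properties using (≤-pred; <⇒≤)
open import Data.Fin using (Fin; zero; suc)
open import Data.Fin.Properties using (suc-injective)
open import Data.Bool using (Bool; true; false)
open import Data.Product using (Σ; ∃; _×_; _,_)
open import Relation.Binary.PropositionalEquality using (_≡_; _≢_; refl; sym; subst)
open import Relation.Nullary using (¬_)

∃-true : ∀ {n} (f : Fin n → Bool) → 1 ≤ count f → ∃ λ y → f y ≡ true
∃-true {ℕ.suc n} f h with f zero in eq
... | true  = zero , eq
... | false with ∃-true (λ i → f (suc i)) h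
...   | y , fy = suc y , fy

∃-true-≢ : ∀ {n} (f : Fin n → Bool) (x : Fin n) → 2 ≤ count f →
  ∃ λ y → f y ≡ true × y ≢ x
∃-true-≢ {ℕ.suc n} f x h with f zero in eq | x
... | true  | suc _ = zero , eq , λ ()
... | true  | zero with ∃-true (λ i → f (suc i)) (≤-pred h)
...   | y , fy = suc y , fy , λ ()
∃-true-≢ f x h | false | zero with ∃-true (λ i → f (suc i)) (<⇒≤ h)
...   | y , fy = suc y , fy , λ ()
∃-true-≢ f x h | false | suc x′ with ∃-true-≢ (λ i → f (suc i)) x′ h
...   | y , fy , y≢x′ = suc y , fy , λ e → y≢x′ (suc-injective e)

noC4⇒¬incident : ∀ {v b} {I : Incidence v b} → NoC4 I →
  ∀ {p q B C} → p ≢ q → B ≢ C →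
  I p B ≡ true → I q B ≡ true → I p C ≡ true → ¬ I q C ≡ true
noC4⇒¬incident noC4 p≢q B≢C pB qB pC qC = noC4 _ _ _ _ p≢q B≢C (pB , pC , qB , qC)

ThreeDisjointEdges : ∀ {v b} → Incidence v b → Set
ThreeDisjointEdges {v} {b} I =
  Σ (Fin v) λ p₁ → Σ (Fin v) λ p₂ → Σ (Fin v) λ p₃ →
  Σ (Fin b) λ B₁ → Σ (Fin b) λ B₂ → Σ (Fin b) λ B₃ →
    (I p₁ B₁ ≡ true × I p₂ B₂ ≡ true × I p₃ B₃ ≡ true) ×
    (¬ p₁ ≡ p₂ × ¬ p₁ ≡ p₃ × ¬ p₂ ≡ p₃) ×
    (¬ B₁ ≡ B₂ × ¬ B₁ ≡ B₃ × ¬ B₂ ≡ B₃)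

noC4⇒threeDisjointEdges : ∀ {v b} (I : Incidence v b) → NoC4 I →
  (∀ p → 2 ≤ count (I p)) → (∀ B → 2 ≤ count (λ p → I p B)) →
  Fin v → ThreeDisjointEdges I
noC4⇒threeDisjointEdges I noC4 pointDeg≥2 blockDeg≥2 p
  with ∃-true (I p) (<⇒≤ (pointDeg≥2 p))
... | B₁ , pB₁ with ∃-true-≢ (I p) B₁ (pointDeg≥2 p)
... | B₂ , pB₂ , B₂≢B₁ with ∃-true-≢ (λ q → I q B₁) p (blockDeg≥2 B₁)
... | q₁ , q₁B₁ , q₁≢p with ∃-true-≢ (λ q → I q B₂) p (blockDeg≥2 B₂)
... | q₂ , q₂B₂ , q₂≢p with ∃-true-≢ (I q₁) B₁ (pointDeg≥2 q₁)
... | C , q₁C , C≢B₁ =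
  q₁ , p , q₂ , C , B₁ , B₂ ,
  (q₁C , pB₁ , q₂B₂) ,
  (q₁≢p , q₁≢q₂ , λ e → q₂≢p (sym e)) ,
  (C≢B₁ , C≢B₂ , λ e → B₂≢B₁ (sym e))
  where
    ¬q₁B₂ : ¬ I q₁ B₂ ≡ true
    ¬q₁B₂ = noC4⇒¬incident noC4 (λ e → q₁≢p (sym e)) (λ e → B₂≢B₁ (sym e)) pB₁ q₁B₁ pB₂

    q₁≢q₂ : q₁ ≢ q₂
    q₁≢q₂ refl = ¬q₁B₂ q₂B₂

    C≢B₂ : C ≢ B₂
    C≢B₂ refl = ¬q₁B₂ q₁C

lemma6 : (v b r k : ℕ) → 2 ≤ r → 2 ≤ k → 1 ≤ v → (I : Incidence v b) →
    IsConfiguration v b r k I →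
    Σ (Fin v) λ p₁ → Σ (Fin v) λ p₂ → Σ (Fin v) λ p₃ →
    Σ (Fin b) λ B₁ → Σ (Fin b) λ B₂ → Σ (Fin b) λ B₃ →
      (I p₁ B₁ ≡ true × I p₂ B₂ ≡ true × I p₃ B₃ ≡ true) ×
      (¬ p₁ ≡ p₂ × ¬ p₁ ≡ p₃ × ¬ p₂ ≡ p₃) ×
      (¬ B₁ ≡ B₂ × ¬ B₁ ≡ B₃ × ¬ B₂ ≡ B₃)
lemma6 (ℕ.suc v) b r k 2≤r 2≤k _ I conf =
  noC4⇒threeDisjointEdges I noC4
    (λ p → subst (2 ≤_) (sym (pointDeg p)) 2≤r)
    (λ B → subst (2 ≤_) (sym (blockDeg B)) 2≤k)
    zero
  where open IsConfiguration conf
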